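{- Let $G$ be a $k$-adjacency dimensional graph and let $k_1,k_2$ be integers with $1\le k_1<k_2\le k$. Then $\operatorname{adim}_{k_1}(G)<\operatorname{adim}_{k_2}(G)$.
   Context: All graphs are finite and simple (not necessarily connected). For a graph $G=(V,E)$, $d_{G,2}(x,y)=\min\{d_G(x,y),2\}$ where $d_G$ is the shortest-path distance ($\infty$ between different components). For distinct $x,y\in V$, $\mathcal{C}_G(x,y)=\{z\in V:\ d_{G,2}(x,z)\neq d_{G,2}(y,z)\}$. A set $S\subseteq V$ is a $k$-adjacency generator if $|S\cap\mathcal{C}_G(x,y)|\ge k$ for all distinct $x,y\in V$; a minimum one is a $k$-adjacency basis, of cardinality $\operatorname{adim}_k(G)$. $G$ is $k$-adjacency dimensional if $k$ is the largest integer for which a $k$-adjacency generator of $G$ exists. -}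

module Defs where

open import Data.Nat using (ℕ; zero; suc; _≤_)
open import Data.Bool using (Bool; true; false)
open import Data.Fin using (Fin; _≟_)
open import Data.Fin.Subset using (Subset; _∩_; ∣_∣)
open import Data.Vec using (tabulate)
open import Data.Product using (Σ; ∃; _×_)
open import Relation.Nullary using (¬_; yes; no)
open import Relation.Binary.PropositionalEquality using (_≡_; _≢_)

record Graph : Set where
  field
    n     : ℕ
    adj   : Fin n → Fin n → Bool
    sym   : ∀ x y → adj x y ≡ adj y x
    irrefl : ∀ x → adj x x ≡ false
open Graph public

-- d_{G,2}(x,z) = min(d_G(x,z), 2): 0 if x = z, 1 if adjacent, 2 otherwise.
d2 : (G : Graph) → Fin (n G) → Fin (n G) → ℕ
d2 G x z with x ≟ z
... | yes _ = 0
... | no _ with adj G x z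
...   | true = 1
...   | false = 2

C : (G : Graph) → Fin (n G) → Fin (n G) → Subset (n G)
C G x y = tabulate λ z → dif (d2 G x z) (d2 G y z)
  where
  open import Data.Nat using () renaming (_≟_ to _≟ℕ_)
  dif : ℕ → ℕ → Bool
  dif a b with a ≟ℕ b
  ... | yes _ = false
  ... | no _ = true

IsKAdjGenerator : (G : Graph) → ℕ → Subset (n G) → Set
IsKAdjGenerator G k S = ∀ x y → x ≢ y → k ≤ ∣ S ∩ C G x y ∣

IsAdim : (G : Graph) → ℕ → ℕ → Set
IsAdim G k m =
  (Σ (Subset (n G)) λ S → IsKAdjGenerator G k S × ∣ S ∣ ≡ m) ×
  (∀ S → IsKAdjGenerator G k S → m ≤ ∣ S ∣)

KAdjDimensional : Graph → ℕ → Set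
KAdjDimensional G k =
  (∃ λ S → IsKAdjGenerator G k S) ×
  (∀ k' → k ≤ k' → (∃ λ S → IsKAdjGenerator G k' S) → k' ≡ k)

-- Removing one vertex from a k₂-adjacency basis costs each set C_G(x,y) at most
-- one element, so it leaves a (k₂ − 1)-adjacency generator, hence a k₁-adjacency
-- generator, strictly smaller than the basis. The only role of k-adjacency
-- dimensionality is to rule out graphs with fewer than two vertices, where every
-- set is a k-adjacency generator for every k.
module Submission where

open import Defs
open import Data.Nat using (ℕ; zero; suc; _≤_; _<_; z≤n; s≤s)
open import Data.Nat.Properties using (≤-refl; ≤-trans; <-≤-trans; n≤1+n; 1+n≢n; ≤-pred)
open import Data.Bool using (_∧_)
open import Data.Fin using (Fin)
open import Data.Fin.Subset using (Subset; Nonempty; _∩_; _-_; ∣_∣; inside; outside)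
open import Data.Fin.Subset.Properties using (∣p∩q∣≤∣p∣; x∈p⇒∣p-x∣<∣p∣; p─⊥≡p)
open import Data.Vec using (_∷_; here; there)
open import Data.Product as Product using (∃; ∃₂; _×_; _,_)
open import Data.Sum using (_⊎_; inj₁; inj₂)
open import Relation.Nullary using (contradiction)
open import Relation.Binary.PropositionalEquality as ≡ using (_≡_; _≢_; refl; subst)

distinct-or-subsingleton : ∀ n → (∃₂ λ (x y : Fin n) → x ≢ y) ⊎ (∀ (x y : Fin n) → x ≡ y)
distinct-or-subsingleton zero          = inj₂ λ ()
distinct-or-subsingleton (suc zero)    = inj₂ λ { Fin.zero Fin.zero → refl }
distinct-or-subsingleton (suc (suc n)) = inj₁ (Fin.zero , Fin.suc Fin.zero , λ ())

0<∣p∣⇒Nonempty : ∀ {n} {p : Subset n} → 0 < ∣ p ∣ → Nonempty p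
0<∣p∣⇒Nonempty {p = inside  ∷ p} _     = Fin.zero , here
0<∣p∣⇒Nonempty {p = outside ∷ p} 0<∣p∣ = Product.map Fin.suc there (0<∣p∣⇒Nonempty 0<∣p∣)

∣x∷p∣≤1+∣p∣ : ∀ {n} x (p : Subset n) → ∣ x ∷ p ∣ ≤ suc ∣ p ∣
∣x∷p∣≤1+∣p∣ inside  p = ≤-refl
∣x∷p∣≤1+∣p∣ outside p = n≤1+n ∣ p ∣

∣p∩q∣≤1+∣p-x∩q∣ : ∀ {n} (p q : Subset n) x → ∣ p ∩ q ∣ ≤ suc ∣ (p - x) ∩ q ∣
-- `rewrite p─⊥≡p p` fails here: the tail of (s ∷ p) - zero is p ─ ⊥ only up to
-- conversion, since `diff` is local to `_─_`; `subst` checks it by conversion.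
∣p∩q∣≤1+∣p-x∩q∣ (s ∷ p) (t ∷ q) Fin.zero =
  subst (λ r → ∣ (s ∷ p) ∩ (t ∷ q) ∣ ≤ suc ∣ r ∩ q ∣) (≡.sym (p─⊥≡p p)) (∣x∷p∣≤1+∣p∣ (s ∧ t) (p ∩ q))
∣p∩q∣≤1+∣p-x∩q∣ (inside  ∷ p) (inside  ∷ q) (Fin.suc x) = s≤s (∣p∩q∣≤1+∣p-x∩q∣ p q x)
∣p∩q∣≤1+∣p-x∩q∣ (inside  ∷ p) (outside ∷ q) (Fin.suc x) = ∣p∩q∣≤1+∣p-x∩q∣ p q x
∣p∩q∣≤1+∣p-x∩q∣ (outside ∷ p) (t       ∷ q) (Fin.suc x) = ∣p∩q∣≤1+∣p-x∩q∣ p q x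

module _ (G : Graph) where

  HasDistinctVertices : Set
  HasDistinctVertices = ∃₂ λ (x y : Fin (n G)) → x ≢ y

  generator-mono : ∀ {k k′} S → k ≤ k′ → IsKAdjGenerator G k′ S → IsKAdjGenerator G k S
  generator-mono S k≤k′ gen x y x≢y = ≤-trans k≤k′ (gen x y x≢y)

  generator-remove : ∀ {k} S → IsKAdjGenerator G (suc k) S → ∀ v → IsKAdjGenerator G k (S - v)
  generator-remove S gen v x y x≢y =
    ≤-pred (≤-trans (gen x y x≢y) (∣p∩q∣≤1+∣p-x∩q∣ S (C G x y) v))

  generator-nonempty : ∀ {k} S → HasDistinctVertices → IsKAdjGenerator G (suc k) S → Nonempty S
  generator-nonempty S (x , y , x≢y) gen =
    0<∣p∣⇒Nonempty (≤-trans (≤-trans (s≤s z≤n) (gen x y x≢y)) (∣p∩q∣≤∣p∣ S (C G x y)))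

  generator-of-subsingleton : (∀ (x y : Fin (n G)) → x ≡ y) → ∀ k S → IsKAdjGenerator G k S
  generator-of-subsingleton trivial k S x y x≢y = contradiction (trivial x y) x≢y

  KAdjDimensional⇒HasDistinctVertices : ∀ {k} → KAdjDimensional G k → HasDistinctVertices
  KAdjDimensional⇒HasDistinctVertices {k} ((S , _) , maximal)
    with distinct-or-subsingleton (n G)
  ... | inj₁ distinct = distinct
  ... | inj₂ trivial  =
    contradiction (maximal (suc k) (n≤1+n k) (S , generator-of-subsingleton trivial (suc k) S))
                  (1+n≢n {k})

  smaller-generator : ∀ {k} S → HasDistinctVertices → IsKAdjGenerator G (suc k) S →
                      ∃ λ S′ → IsKAdjGenerator G k S′ × ∣ S′ ∣ < ∣ S ∣
  smaller-generator S distinct gen with generator-nonempty S distinct gen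
  ... | v , v∈S = S - v , generator-remove S gen v , x∈p⇒∣p-x∣<∣p∣ v∈S

  adim-strictly-increasing : ∀ {k₁ k₂ m₁ m₂} → HasDistinctVertices → k₁ < k₂ →
                             IsAdim G k₁ m₁ → IsAdim G k₂ m₂ → m₁ < m₂
  adim-strictly-increasing distinct k₁<k₂ (_ , minimal) ((S , gen , refl) , _) =
    let S′ , gen′ , ∣S′∣<∣S∣ = smaller-generator S distinct (generator-mono S k₁<k₂ gen)
    in  <-≤-trans (s≤s (minimal S′ gen′)) ∣S′∣<∣S∣

theorem10 : (G : Graph) (k k₁ k₂ : ℕ) → KAdjDimensional G k →
    1 ≤ k₁ → k₁ < k₂ → k₂ ≤ k →
    ∀ m₁ m₂ → IsAdim G k₁ m₁ → IsAdim G k₂ m₂ → m₁ < m₂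
theorem10 G k k₁ k₂ dimensional _ k₁<k₂ _ m₁ m₂ =
  adim-strictly-increasing G (KAdjDimensional⇒HasDistinctVertices G dimensional) k₁<k₂
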